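{- Let $\mathbb{F}$ be a field, $M\in\mathbb{F}^2$ and $r\in\mathbb{F}^{*}$. Then the circle $C(M,r)_{\mathbb{F}}$ has the uniformity property.
   Context: $C(M,r)_{\mathbb{F}}=\{(x,y)\in\mathbb{F}^2:(x-m_1)^2+(y-m_2)^2=r^2\}$ for $M=(m_1,m_2)$; $D^2((p_1,p_2),(q_1,q_2))=(p_1-q_1)^2+(p_2-q_2)^2$. A subset (curve) $\mathcal{C}\subseteq\mathbb{F}^2$ has the uniformity property if for any two points $P,Q\in\mathcal{C}$, any $n\in\mathbb{N}$ and any $d\in\mathbb{F}$: if there are $n$ pairwise different points $R_1,\dots,R_n\in\mathcal{C}$ with $D^2(P,R_i)=d$ for all $i$, then there are $n$ pairwise different points $S_1,\dots,S_n\in\mathcal{C}$ with $D^2(Q,S_i)=d$ for all $i$. -}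

module Defs where

open import Level using (Level; _⊔_) renaming (suc to lsuc)
open import Algebra.Bundles using (CommutativeRing)
open import Data.Product using (Σ; _×_; _,_; ∃)
open import Data.Nat using (ℕ)
open import Data.Fin using (Fin)
open import Relation.Nullary using (¬_)
open import Relation.Binary.PropositionalEquality using (_≢_)

record Field (c ℓ : Level) : Set (lsuc (c ⊔ ℓ)) where
  field
    commutativeRing : CommutativeRing c ℓ
  open CommutativeRing commutativeRing public
  field
    1≉0     : ¬ (1# ≈ 0#)
    inverse : ∀ x → ¬ (x ≈ 0#) → Σ Carrier (λ y → x * y ≈ 1#)

module Plane {c ℓ : Level} (F : Field c ℓ) where
  open Field F

  Point : Set c
  Point = Carrier × Carrier

  _≈ₚ_ : Point → Point → Set ℓ
  (p₁ , p₂) ≈ₚ (q₁ , q₂) = (p₁ ≈ q₁) × (p₂ ≈ q₂)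

  sq : Carrier → Carrier
  sq x = x * x

  D² : Point → Point → Carrier
  D² (p₁ , p₂) (q₁ , q₂) = sq (p₁ - q₁) + sq (p₂ - q₂)

  Circle : Point → Carrier → Point → Set ℓ
  Circle (m₁ , m₂) r (x , y) = sq (x - m₁) + sq (y - m₂) ≈ sq r

  HasEquidistant : (Point → Set ℓ) → Point → ℕ → Carrier → Set (c ⊔ ℓ)
  HasEquidistant 𝒞 P n d =
    Σ (Fin n → Point) λ R →
        (∀ i → 𝒞 (R i))
      × (∀ i j → i ≢ j → ¬ (R i ≈ₚ R j))
      × (∀ i → D² P (R i) ≈ d)

  Uniformity : (Point → Set ℓ) → Set (c ⊔ ℓ)
  Uniformity 𝒞 = ∀ P Q → 𝒞 P → 𝒞 Q → (n : ℕ) (d : Carrier) →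
    HasEquidistant 𝒞 P n d → HasEquidistant 𝒞 Q n d

-- Rotations about M with cosine α and sine β, where α² + β² = 1, are
-- invertible isometries of F² mapping the circle C(M,r) onto itself.  For
-- P, Q on the circle put a = P − M and b = Q − M; as |a|² = |b|² = r² ≠ 0,
-- the pair α = ⟨a,b⟩/r², β = (a × b)/r² satisfies α² + β² = |a|²|b|²/r⁴ = 1
-- and the rotation maps P to Q.  It carries n points of the circle that are
-- equidistant from P to n points equidistant from Q.
module Submission where

open import Level using (Level; _⊔_)
open import Algebra.Bundles using (CommutativeRing; RawRing)
open import Algebra.Solver.Ring.AlmostCommutativeRing
  using (fromCommutativeRing; _-Raw-AlmostCommutative⟶_)
import Algebra.Solver.Ring as RingSolver
import Algebra.Properties.AbelianGroup as AbelianGroupProperties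
import Algebra.Properties.CommutativeSemigroup as CommutativeSemigroupProperties
import Algebra.Properties.Ring as RingProperties
import Algebra.Properties.Semiring.Mult as SemiringMult
open import Data.Nat as ℕ using (ℕ; zero; suc)
open import Data.Nat.Properties using (+-suc)
open import Data.Integer as ℤ using (ℤ; +_; -[1+_]; _⊖_; sign; ∣_∣; _◃_)
open import Data.Integer.Properties using ([1+m]⊖[1+n]≡m⊖n)
open import Data.Sign as Sign using (Sign)
import Data.Maybe as Maybe
open import Data.Product using (Σ; _,_; proj₁; proj₂)
open import Data.Product.Relation.Binary.Pointwise.NonDependent using (×-setoid)
open import Relation.Binary.Bundles using (Setoid)
open import Relation.Binary.PropositionalEquality using (_≡_; cong)
open import Relation.Nullary using (¬_)
open import Relation.Nullary.Decidable using (dec⇒maybe)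

open import Defs

ℤ-rawRing : RawRing _ _
ℤ-rawRing = record
  { Carrier = ℤ ; _≈_ = _≡_ ; _+_ = ℤ._+_ ; _*_ = ℤ._*_ ; -_ = ℤ.-_ ; 0# = + 0 ; 1# = + 1 }

-- A ring solver for an arbitrary commutative ring, with integer coefficients
-- mapped in along the canonical homomorphism ℤ → R; integer arithmetic
-- computes, so cancelling coefficients normalise definitionally.
module IntegerCoefficients {c ℓ : Level} (R : CommutativeRing c ℓ) where
  open CommutativeRing R
  open SemiringMult semiring using (×-homo-+; ×1-homo-*) renaming (_×_ to _·_)
  open RingProperties ring using (-1*x≈-x; -‿distribʳ-*)
  open AbelianGroupProperties +-abelianGroup using (ε⁻¹≈ε; ⁻¹-involutive; ⁻¹-∙-comm)
  open CommutativeSemigroupProperties +-commutativeSemigroup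
    renaming (interchange to +-interchange)
  open CommutativeSemigroupProperties *-commutativeSemigroup
    renaming (interchange to *-interchange)
  open import Relation.Binary.Reasoning.Setoid setoid

  fromℕ : ℕ → Carrier
  fromℕ n = n · 1#

  fromℤ : ℤ → Carrier
  fromℤ (+ n)    = fromℕ n
  fromℤ -[1+ n ] = - fromℕ (suc n)

  fromSign : Sign → Carrier
  fromSign Sign.+ = 1#
  fromSign Sign.- = - 1#

  fromSign-homo-* : ∀ s t → fromSign (s Sign.* t) ≈ fromSign s * fromSign t
  fromSign-homo-* Sign.- Sign.- = begin
    1#            ≈⟨ ⁻¹-involutive 1# ⟨
    - - 1#        ≈⟨ -‿cong (-1*x≈-x 1#) ⟨
    - (- 1# * 1#) ≈⟨ -‿distribʳ-* (- 1#) 1# ⟩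
    - 1# * - 1#   ∎
  fromSign-homo-* Sign.- Sign.+ = sym (*-identityʳ _)
  fromSign-homo-* Sign.+ t      = sym (*-identityˡ _)

  fromℤ-homo-◃ : ∀ s n → fromℤ (s ◃ n) ≈ fromSign s * fromℕ n
  fromℤ-homo-◃ s       zero    = sym (zeroʳ _)
  fromℤ-homo-◃ Sign.+ (suc n) = sym (*-identityˡ _)
  fromℤ-homo-◃ Sign.- (suc n) = sym (-1*x≈-x _)

  fromℤ≈sign*abs : ∀ i → fromℤ i ≈ fromSign (sign i) * fromℕ ∣ i ∣
  fromℤ≈sign*abs (+ n)    = sym (*-identityˡ _)
  fromℤ≈sign*abs -[1+ n ] = sym (-1*x≈-x _)

  x-0≈x : ∀ x → x - 0# ≈ x
  x-0≈x x = trans (+-congˡ ε⁻¹≈ε) (+-identityʳ x)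

  fromℤ-homo-⊖ : ∀ m n → fromℤ (m ⊖ n) ≈ fromℕ m - fromℕ n
  fromℤ-homo-⊖ zero    zero    = sym (x-0≈x 0#)
  fromℤ-homo-⊖ zero    (suc n) = sym (+-identityˡ _)
  fromℤ-homo-⊖ (suc m) zero    = sym (x-0≈x _)
  fromℤ-homo-⊖ (suc m) (suc n) = begin
    fromℤ (suc m ⊖ suc n)            ≡⟨ cong fromℤ ([1+m]⊖[1+n]≡m⊖n m n) ⟩
    fromℤ (m ⊖ n)                    ≈⟨ fromℤ-homo-⊖ m n ⟩
    a - b                            ≈⟨ +-identityˡ _ ⟨
    0# + (a - b)                     ≈⟨ +-congʳ (-‿inverseʳ 1#) ⟨
    (1# - 1#) + (a - b)              ≈⟨ +-interchange 1# (- 1#) a (- b) ⟩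
    (1# + a) + (- 1# - b)            ≈⟨ +-congˡ (⁻¹-∙-comm 1# b) ⟩
    (1# + a) - (1# + b)              ∎
    where
    a = fromℕ m
    b = fromℕ n

  fromℤ-homo-+ : ∀ i j → fromℤ (i ℤ.+ j) ≈ fromℤ i + fromℤ j
  fromℤ-homo-+ -[1+ m ] -[1+ n ] = begin
    - fromℕ (suc (suc (m ℕ.+ n)))     ≡⟨ cong (λ k → - fromℕ k) (+-suc (suc m) n) ⟨
    - fromℕ (suc m ℕ.+ suc n)         ≈⟨ -‿cong (×-homo-+ 1# (suc m) (suc n)) ⟩
    - (fromℕ (suc m) + fromℕ (suc n)) ≈⟨ ⁻¹-∙-comm _ _ ⟨
    - fromℕ (suc m) - fromℕ (suc n)   ∎
  fromℤ-homo-+ -[1+ m ] (+ n)    = trans (fromℤ-homo-⊖ n (suc m)) (+-comm _ _)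
  fromℤ-homo-+ (+ m)    -[1+ n ] = fromℤ-homo-⊖ m (suc n)
  fromℤ-homo-+ (+ m)    (+ n)    = ×-homo-+ 1# m n

  fromℤ-homo-* : ∀ i j → fromℤ (i ℤ.* j) ≈ fromℤ i * fromℤ j
  fromℤ-homo-* i j = begin
    fromℤ (sign i Sign.* sign j ◃ ∣ i ∣ ℕ.* ∣ j ∣)
      ≈⟨ fromℤ-homo-◃ (sign i Sign.* sign j) (∣ i ∣ ℕ.* ∣ j ∣) ⟩
    fromSign (sign i Sign.* sign j) * fromℕ (∣ i ∣ ℕ.* ∣ j ∣)
      ≈⟨ *-cong (fromSign-homo-* (sign i) (sign j)) (×1-homo-* ∣ i ∣ ∣ j ∣) ⟩
    (fromSign (sign i) * fromSign (sign j)) * (fromℕ ∣ i ∣ * fromℕ ∣ j ∣)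
      ≈⟨ *-interchange _ _ _ _ ⟩
    (fromSign (sign i) * fromℕ ∣ i ∣) * (fromSign (sign j) * fromℕ ∣ j ∣)
      ≈⟨ *-cong (fromℤ≈sign*abs i) (fromℤ≈sign*abs j) ⟨
    fromℤ i * fromℤ j ∎

  fromℤ-homo-‿ : ∀ i → fromℤ (ℤ.- i) ≈ - fromℤ i
  fromℤ-homo-‿ -[1+ n ]    = sym (⁻¹-involutive _)
  fromℤ-homo-‿ (+ zero)    = sym ε⁻¹≈ε
  fromℤ-homo-‿ (+ (suc n)) = refl

  fromℤ-homomorphism : ℤ-rawRing -Raw-AlmostCommutative⟶ fromCommutativeRing R
  fromℤ-homomorphism = record
    { ⟦_⟧    = fromℤ
    ; +-homo = fromℤ-homo-+
    ; *-homo = fromℤ-homo-*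
    ; -‿homo = fromℤ-homo-‿
    ; 0-homo = refl
    ; 1-homo = +-identityʳ 1#
    }

  open RingSolver ℤ-rawRing (fromCommutativeRing R) fromℤ-homomorphism
    (λ i j → Maybe.map (λ i≡j → reflexive (cong fromℤ i≡j)) (dec⇒maybe (i ℤ.≟ j)))
    public
    using (solve; _:+_; :-_; _:-_; _:*_; _:=_)

module _ {c ℓ : Level} (F : Field c ℓ) where
  open Field F
  open Plane F
  open IntegerCoefficients commutativeRing using (solve; _:+_; :-_; _:-_; _:*_; _:=_)
  open import Relation.Binary.Reasoning.Setoid setoid
  module ≈ₚ = Setoid (×-setoid setoid setoid)

  D²-congˡ : ∀ {P P′} Q → P ≈ₚ P′ → D² P Q ≈ D² P′ Q
  D²-congˡ Q (e₁ , e₂) =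
    +-cong (*-cong (+-congʳ e₁) (+-congʳ e₁)) (*-cong (+-congʳ e₂) (+-congʳ e₂))

  record Symmetry (𝒞 : Point → Set ℓ) : Set (c ⊔ ℓ) where
    field
      map       : Point → Point
      preserves : ∀ {X} → 𝒞 X → 𝒞 (map X)
      injective : ∀ X Y → map X ≈ₚ map Y → X ≈ₚ Y
      isometry  : ∀ X Y → D² (map X) (map Y) ≈ D² X Y

  Transitive : (Point → Set ℓ) → Set (c ⊔ ℓ)
  Transitive 𝒞 = ∀ {P Q} → 𝒞 P → 𝒞 Q → Σ (Symmetry 𝒞) λ T → Symmetry.map T P ≈ₚ Q

  transitive⇒uniformity : ∀ 𝒞 → Transitive 𝒞 → Uniformity 𝒞
  transitive⇒uniformity 𝒞 transitive P Q 𝒞P 𝒞Q n d (R , 𝒞R , R-distinct , PR≈d) =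
    (λ i → map (R i)) ,
    (λ i → preserves (𝒞R i)) ,
    (λ i j i≢j TRi≈TRj → R-distinct i j i≢j (injective (R i) (R j) TRi≈TRj)) ,
    λ i → begin
      D² Q (map (R i))       ≈⟨ D²-congˡ (map (R i)) TP≈Q ⟨
      D² (map P) (map (R i)) ≈⟨ isometry P (R i) ⟩
      D² P (R i)             ≈⟨ PR≈d i ⟩
      d                      ∎
    where
    T : Symmetry 𝒞
    T = proj₁ (transitive 𝒞P 𝒞Q)
    TP≈Q : Symmetry.map T P ≈ₚ Q
    TP≈Q = proj₂ (transitive 𝒞P 𝒞Q)
    open Symmetry T

  rotate : Point → Carrier → Carrier → Point → Point
  rotate (m₁ , m₂) α β (x₁ , x₂) =
    m₁ + (α * (x₁ - m₁) - β * (x₂ - m₂)) , m₂ + (β * (x₁ - m₁) + α * (x₂ - m₂))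

  rotate-D² : ∀ M α β X Y →
    D² (rotate M α β X) (rotate M α β Y) ≈ (sq α + sq β) * D² X Y
  rotate-D² (m₁ , m₂) α β (x₁ , x₂) (y₁ , y₂) =
    solve 8 (λ α β m₁ m₂ x₁ x₂ y₁ y₂ →
      let u₁ = (m₁ :+ (α :* (x₁ :- m₁) :- β :* (x₂ :- m₂)))
             :- (m₁ :+ (α :* (y₁ :- m₁) :- β :* (y₂ :- m₂)))
          u₂ = (m₂ :+ (β :* (x₁ :- m₁) :+ α :* (x₂ :- m₂)))
             :- (m₂ :+ (β :* (y₁ :- m₁) :+ α :* (y₂ :- m₂)))
      in u₁ :* u₁ :+ u₂ :* u₂
         := (α :* α :+ β :* β) :* ((x₁ :- y₁) :* (x₁ :- y₁) :+ (x₂ :- y₂) :* (x₂ :- y₂)))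
      refl α β m₁ m₂ x₁ x₂ y₁ y₂

  rotate-D²-centre : ∀ M α β X →
    D² (rotate M α β X) M ≈ (sq α + sq β) * D² X M
  rotate-D²-centre (m₁ , m₂) α β (x₁ , x₂) =
    solve 6 (λ α β m₁ m₂ x₁ x₂ →
      let u₁ = (m₁ :+ (α :* (x₁ :- m₁) :- β :* (x₂ :- m₂))) :- m₁
          u₂ = (m₂ :+ (β :* (x₁ :- m₁) :+ α :* (x₂ :- m₂))) :- m₂
      in u₁ :* u₁ :+ u₂ :* u₂
         := (α :* α :+ β :* β) :* ((x₁ :- m₁) :* (x₁ :- m₁) :+ (x₂ :- m₂) :* (x₂ :- m₂)))
      refl α β m₁ m₂ x₁ x₂

  x≈1⇒x*y≈y : ∀ {x} y → x ≈ 1# → x * y ≈ y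
  x≈1⇒x*y≈y y x≈1 = trans (*-congʳ x≈1) (*-identityˡ y)

  offset-by-unit : ∀ m x {u} → u ≈ 1# → m + u * (x - m) ≈ x
  offset-by-unit m x {u} u≈1 = begin
    m + u * (x - m) ≈⟨ +-congˡ (x≈1⇒x*y≈y (x - m) u≈1) ⟩
    m + (x - m)     ≈⟨ solve 2 (λ m x → m :+ (x :- m) := x) refl m x ⟩
    x               ∎

  rotate-cong : ∀ M α β {X Y} → X ≈ₚ Y → rotate M α β X ≈ₚ rotate M α β Y
  rotate-cong M α β (e₁ , e₂) =
    +-congˡ (+-cong (*-congˡ (+-congʳ e₁)) (-‿cong (*-congˡ (+-congʳ e₂)))) ,
    +-congˡ (+-cong (*-congˡ (+-congʳ e₁)) (*-congˡ (+-congʳ e₂)))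

  rotate-inverse : ∀ M α β X → sq α + sq β ≈ 1# → rotate M α (- β) (rotate M α β X) ≈ₚ X
  rotate-inverse (m₁ , m₂) α β (x₁ , x₂) unit =
    trans (solve 6 (λ α β m₁ m₂ x₁ x₂ →
        m₁ :+ (α :* ((m₁ :+ (α :* (x₁ :- m₁) :- β :* (x₂ :- m₂))) :- m₁)
               :- (:- β) :* ((m₂ :+ (β :* (x₁ :- m₁) :+ α :* (x₂ :- m₂))) :- m₂))
        := m₁ :+ (α :* α :+ β :* β) :* (x₁ :- m₁))
      refl α β m₁ m₂ x₁ x₂) (offset-by-unit m₁ x₁ unit) ,
    trans (solve 6 (λ α β m₁ m₂ x₁ x₂ →
        m₂ :+ ((:- β) :* ((m₁ :+ (α :* (x₁ :- m₁) :- β :* (x₂ :- m₂))) :- m₁)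
               :+ α :* ((m₂ :+ (β :* (x₁ :- m₁) :+ α :* (x₂ :- m₂))) :- m₂))
        := m₂ :+ (α :* α :+ β :* β) :* (x₂ :- m₂))
      refl α β m₁ m₂ x₁ x₂) (offset-by-unit m₂ x₂ unit)

  rotate-injective : ∀ M α β → sq α + sq β ≈ 1# →
    ∀ X Y → rotate M α β X ≈ₚ rotate M α β Y → X ≈ₚ Y
  rotate-injective M α β unit X Y e = ≈ₚ.trans (≈ₚ.sym (rotate-inverse M α β X unit))
    (≈ₚ.trans (rotate-cong M α (- β) e) (rotate-inverse M α β Y unit))

  rotation-symmetry : ∀ M r α β → sq α + sq β ≈ 1# → Symmetry (Circle M r)
  rotation-symmetry M r α β unit = record
    { map       = rotate M α β
    ; preserves = λ {X} onCircle →
        trans (rotate-D²-centre M α β X) (trans (x≈1⇒x*y≈y (D² X M) unit) onCircle)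
    ; injective = rotate-injective M α β unit
    ; isometry  = λ X Y → trans (rotate-D² M α β X Y) (x≈1⇒x*y≈y (D² X Y) unit)
    }

  sq-inverse : ∀ {r s} → r * s ≈ 1# → sq r * sq s ≈ 1#
  sq-inverse {r} {s} rs≈1 = begin
    (r * r) * (s * s) ≈⟨ solve 2 (λ r s → (r :* r) :* (s :* s) := (r :* s) :* (r :* s)) refl r s ⟩
    (r * s) * (r * s) ≈⟨ x≈1⇒x*y≈y (r * s) rs≈1 ⟩
    r * s             ≈⟨ rs≈1 ⟩
    1#                ∎

  brahmagupta-fibonacci : ∀ a₁ a₂ b₁ b₂ k →
    sq ((a₁ * b₁ + a₂ * b₂) * k) + sq ((a₁ * b₂ - a₂ * b₁) * k)
      ≈ ((sq a₁ + sq a₂) * k) * ((sq b₁ + sq b₂) * k)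
  brahmagupta-fibonacci = solve 5 (λ a₁ a₂ b₁ b₂ k →
    let α = (a₁ :* b₁ :+ a₂ :* b₂) :* k
        β = (a₁ :* b₂ :- a₂ :* b₁) :* k
    in α :* α :+ β :* β
       := ((a₁ :* a₁ :+ a₂ :* a₂) :* k) :* ((b₁ :* b₁ :+ b₂ :* b₂) :* k))
    refl

  circle-transitive : ∀ M {r} → ¬ r ≈ 0# → Transitive (Circle M r)
  circle-transitive (m₁ , m₂) {r} r≉0 {p₁ , p₂} {q₁ , q₂} |a|²≈r² |b|²≈r² =
    rotation-symmetry (m₁ , m₂) r α β unit , P↦Q
    where
    a₁ a₂ b₁ b₂ k α β : Carrier
    a₁ = p₁ - m₁
    a₂ = p₂ - m₂
    b₁ = q₁ - m₁
    b₂ = q₂ - m₂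
    k = sq (proj₁ (inverse r r≉0))
    α = (a₁ * b₁ + a₂ * b₂) * k
    β = (a₁ * b₂ - a₂ * b₁) * k

    r²k≈1 : sq r * k ≈ 1#
    r²k≈1 = sq-inverse (proj₂ (inverse r r≉0))

    |a|²k≈1 : (sq a₁ + sq a₂) * k ≈ 1#
    |a|²k≈1 = trans (*-congʳ |a|²≈r²) r²k≈1

    |b|²k≈1 : (sq b₁ + sq b₂) * k ≈ 1#
    |b|²k≈1 = trans (*-congʳ |b|²≈r²) r²k≈1

    unit : sq α + sq β ≈ 1#
    unit = begin
      sq α + sq β                                   ≈⟨ brahmagupta-fibonacci a₁ a₂ b₁ b₂ k ⟩
      ((sq a₁ + sq a₂) * k) * ((sq b₁ + sq b₂) * k) ≈⟨ x≈1⇒x*y≈y _ |a|²k≈1 ⟩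
      (sq b₁ + sq b₂) * k                           ≈⟨ |b|²k≈1 ⟩
      1#                                            ∎

    P↦Q : rotate (m₁ , m₂) α β (p₁ , p₂) ≈ₚ (q₁ , q₂)
    P↦Q = trans (+-congˡ first) (offset-by-unit m₁ q₁ |a|²k≈1) ,
          trans (+-congˡ second) (offset-by-unit m₂ q₂ |a|²k≈1)
      where
      first : α * a₁ - β * a₂ ≈ ((sq a₁ + sq a₂) * k) * b₁
      first = solve 5 (λ a₁ a₂ b₁ b₂ k →
          ((a₁ :* b₁ :+ a₂ :* b₂) :* k) :* a₁ :- ((a₁ :* b₂ :- a₂ :* b₁) :* k) :* a₂
          := ((a₁ :* a₁ :+ a₂ :* a₂) :* k) :* b₁)
        refl a₁ a₂ b₁ b₂ k
      second : β * a₁ + α * a₂ ≈ ((sq a₁ + sq a₂) * k) * b₂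
      second = solve 5 (λ a₁ a₂ b₁ b₂ k →
          ((a₁ :* b₂ :- a₂ :* b₁) :* k) :* a₁ :+ ((a₁ :* b₁ :+ a₂ :* b₂) :* k) :* a₂
          := ((a₁ :* a₁ :+ a₂ :* a₂) :* k) :* b₂)
        refl a₁ a₂ b₁ b₂ k

mainTheorem10 : ∀ {c ℓ : Level} (F : Field c ℓ) (M : Plane.Point F) (r : Field.Carrier F) →
    ¬ (Field._≈_ F r (Field.0# F)) →
    Plane.Uniformity F (Plane.Circle F M r)
mainTheorem10 F M r r≉0 =
  transitive⇒uniformity F (Plane.Circle F M r) (circle-transitive F M r≉0)
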